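{- For $k\in\{1,3\}$, every finite multiset $G$ of I/O pairs and every pair $(B,Y)$: the I/O sequent $G\vdash(B,Y)$ is derivable in the calculus $\mathbf{C}_k$ if and only if $G\vdash_{OUT_k^+}(B,Y)$.
   Context: Formulas are classical propositional formulas built with $\top,\bot,\neg,\wedge,\vee,\to$; $\models$ denotes classical semantic entailment. An I/O pair is an ordered pair $(A,X)$ of formulas. Rules on pairs: (TOP) $(\top,\top)$ is derivable from no premises; (BOT) $(\bot,\bot)$ is derivable from no premises; (WO) from $(A,X)$ derive $(A,Y)$ whenever $X\models Y$; (SI) from $(A,X)$ derive $(B,X)$ whenever $B\models A$; (AND) from $(A,X_1)$ and $(A,X_2)$ derive $(A,X_1\wedge X_2)$; (CT) from $(A,X)$ and $(A\wedge X,Y)$ derive $(A,Y)$. The logic $OUT_1^+$ consists of TOP, BOT, WO, SI, AND; $OUT_3^+$ is $OUT_1^+$ plus CT. $G\vdash_{L}(B,Y)$ means there is a finite tree with root $(B,Y)$, each leaf an element of $G$ or an axiom of $L$, and each non-leaf node obtained from its children by a rule of $L$. An LK sequent $\Gamma\Rightarrow\Delta$ is derivable in LK iff $\bigwedge\Gamma\models\bigvee\Delta$ (empty conjunction $=\top$, empty disjunction $=\bot$). An I/O sequent has the form $G\vdash(B,Y)$ with $G$ a finite multiset of pairs. Rules: (IN) from $B\Rightarrow$ infer $G\vdash(B,Y)$; (OUT) from $\Rightarrow Y$ infer $G\vdash(B,Y)$; (E1) from the LK sequent $B\Rightarrow A$ and $G\vdash(B,Y\vee\neg X)$ infer $(A,X),G\vdash(B,Y)$;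 (E3) from the LK sequent $B\Rightarrow A$ and $G\vdash(B\wedge X,Y\vee\neg X)$ infer $(A,X),G\vdash(B,Y)$. The calculus $\mathbf{C}_1$ has rules IN, OUT, E1; $\mathbf{C}_3$ has IN, OUT, E3. An I/O sequent is derivable in $\mathbf{C}_k$ if it is the root of a finite tree built with its rules in which every LK-sequent premise is derivable in LK. -}

module Defs where

open import Data.Nat using (ℕ)
open import Data.Bool using (Bool; true; false; not; _∧_; _∨_)
open import Data.List using (List; []; _∷_; foldr)
open import Data.List.Membership.Propositional using (_∈_)
open import Data.List.Relation.Binary.Permutation.Propositional using (_↭_)
open import Data.Product using (_×_; _,_)
open import Relation.Binary.PropositionalEquality using (_≡_)

data Fm : Set where
  var : ℕ → Fm
  ⊤f ⊥f : Fm
  ¬f_ : Fm → Fm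
  _∧f_ _∨f_ _→f_ : Fm → Fm → Fm

infixr 30 _∧f_
infixr 25 _∨f_
infixr 20 _→f_
infix 40 ¬f_

Val : Set
Val = ℕ → Bool

⟦_⟧ : Fm → Val → Bool
⟦ var n ⟧ v = v n
⟦ ⊤f ⟧ v = true
⟦ ⊥f ⟧ v = false
⟦ ¬f A ⟧ v = not (⟦ A ⟧ v)
⟦ A ∧f B ⟧ v = ⟦ A ⟧ v ∧ ⟦ B ⟧ v
⟦ A ∨f B ⟧ v = ⟦ A ⟧ v ∨ ⟦ B ⟧ v
⟦ A →f B ⟧ v = not (⟦ A ⟧ v) ∨ ⟦ B ⟧ v

infix 10 _⊨_
_⊨_ : Fm → Fm → Set
A ⊨ B = (v : Val) → ⟦ A ⟧ v ≡ true → ⟦ B ⟧ v ≡ true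

-- LK sequents Γ ⇒ Δ; derivable in LK iff ⋀Γ ⊨ ⋁Δ
⋀ ⋁ : List Fm → Fm
⋀ = foldr _∧f_ ⊤f
⋁ = foldr _∨f_ ⊥f

LK : List Fm → List Fm → Set
LK Γ Δ = ⋀ Γ ⊨ ⋁ Δ

Pair : Set
Pair = Fm × Fm

data Level : Set where
  one three : Level

data OutDer (k : Level) (G : List Pair) : Pair → Set where
  leaf : ∀ {p} → p ∈ G → OutDer k G p
  TOP  : OutDer k G (⊤f , ⊤f)
  BOT  : OutDer k G (⊥f , ⊥f)
  WO   : ∀ {A X Y} → OutDer k G (A , X) → X ⊨ Y → OutDer k G (A , Y)
  SI   : ∀ {A B X} → OutDer k G (A , X) → B ⊨ A → OutDer k G (B , X)
  AND  : ∀ {A X₁ X₂} → OutDer k G (A , X₁) → OutDer k G (A , X₂)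
         → OutDer k G (A , X₁ ∧f X₂)
  CT   : ∀ {A X Y} → k ≡ three → OutDer k G (A , X) → OutDer k G (A ∧f X , Y)
         → OutDer k G (A , Y)

-- Sequent calculi C_1 / C_3 for I/O sequents G ⊢ (B,Y); G a finite multiset
-- (a list up to permutation: the principal pair may be any element of G)
data Calc : Level → List Pair → Pair → Set where
  IN  : ∀ {k G B Y} → LK (B ∷ []) [] → Calc k G (B , Y)
  OUT : ∀ {k G B Y} → LK [] (Y ∷ []) → Calc k G (B , Y)
  E1  : ∀ {G G' A X B Y} → G ↭ ((A , X) ∷ G')
        → LK (B ∷ []) (A ∷ []) → Calc one G' (B , Y ∨f ¬f X)
        → Calc one G (B , Y)
  E3  : ∀ {G G' A X B Y} → G ↭ ((A , X) ∷ G')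
        → LK (B ∷ []) (A ∷ []) → Calc three G' (B ∧f X , Y ∨f ¬f X)
        → Calc three G (B , Y)

-- A derivation of (B , Y) in OUT_k^+ can be flattened into a sequence of pairs
-- of G that fire one after the other: each input is entailed by the current
-- input (B itself for k = 1, B conjoined with the outputs fired so far for
-- k = 3), and at the end either the current input is inconsistent or the
-- fired outputs entail Y.  Each rule of OUT_k^+ preserves the existence of
-- such a sequence, and conversely a sequence is read off as a C_k derivation
-- whose E-steps fire its pairs in order.  Since an E-step consumes its pair,
-- later repetitions of a fired pair are deleted first; they are redundant, as
-- the input already contains the output they would add.
module Submission where

open import Defs
open import Data.List using (List)
open import Data.Product using (_×_)
open import Function.Bundles using (_⇔_)

open import Data.Bool using (true; false; not; _∧_; _∨_)
open import Data.Nat using (zero; suc)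
open import Data.Nat.Properties using (suc-injective)
open import Data.List using ([]; _∷_; _++_; map; foldl; length)
open import Data.List.Properties using (foldl-++; map-++; length-removeAt′)
open import Data.List.Relation.Unary.All using (All; []; _∷_)
open import Data.List.Relation.Unary.All.Properties using (++⁺)
open import Data.List.Relation.Unary.Any using (here; there; index)
open import Data.List.Membership.Propositional using (_∈_; _─_)
open import Data.List.Relation.Binary.Subset.Propositional using (_⊆_)
open import Data.List.Relation.Binary.Permutation.Propositional
  using (_↭_; ↭-refl; ↭-sym; ↭-trans; prep; swap)
open import Data.List.Relation.Binary.Permutation.Propositional.Properties
  using (∈-resp-↭)
open import Data.Product using (Σ-syntax; _,_; proj₁; proj₂)
open import Data.Sum using (_⊎_; inj₁; inj₂)
import Data.Sum as Sum
open import Data.Unit using (⊤; tt)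
open import Function.Bundles using (mk⇔)
open import Relation.Binary.PropositionalEquality using (_≡_; refl; sym; trans; cong)

private
  variable
    k : Level
    G G' S S₁ S₂ T : List Pair
    A B C X Y Z : Fm

∧-true⁻ : ∀ {a b} → a ∧ b ≡ true → a ≡ true × b ≡ true
∧-true⁻ {true} b≡true = refl , b≡true

∧-true⁺ : ∀ {a b} → a ≡ true → b ≡ true → a ∧ b ≡ true
∧-true⁺ refl refl = refl

-- Since A ⊨ B unfolds to a function type, Agda cannot recover A and B from
-- it; this record wrapper makes the formulas inferable.
infix 10 _⊨′_
record _⊨′_ (A B : Fm) : Set where
  constructor ⊨⇒⊨′
  field ⊨′⇒⊨ : A ⊨ B
open _⊨′_

⊨-refl : A ⊨′ A
⊨-refl = ⊨⇒⊨′ λ _ a → a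

⊨-reflexive : A ≡ B → A ⊨′ B
⊨-reflexive refl = ⊨-refl

⊨-trans : A ⊨′ B → B ⊨′ C → A ⊨′ C
⊨-trans (⊨⇒⊨′ A⊨B) (⊨⇒⊨′ B⊨C) = ⊨⇒⊨′ λ v a → B⊨C v (A⊨B v a)

⊥-⊨ : ⊥f ⊨′ A
⊥-⊨ = ⊨⇒⊨′ λ _ ()

⊨-⊤ : A ⊨′ ⊤f
⊨-⊤ = ⊨⇒⊨′ λ _ _ → refl

∧-⊨ˡ : A ∧f B ⊨′ A
∧-⊨ˡ = ⊨⇒⊨′ λ _ ab → proj₁ (∧-true⁻ ab)

∧-⊨ʳ : A ∧f B ⊨′ B
∧-⊨ʳ = ⊨⇒⊨′ λ _ ab → proj₂ (∧-true⁻ ab)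

⊨-∧ : C ⊨′ A → C ⊨′ B → C ⊨′ A ∧f B
⊨-∧ (⊨⇒⊨′ C⊨A) (⊨⇒⊨′ C⊨B) = ⊨⇒⊨′ λ v c → ∧-true⁺ (C⊨A v c) (C⊨B v c)

⊨-∨ˡ : A ⊨′ A ∨f B
⊨-∨ˡ {A} = ⊨⇒⊨′ λ v a → ∨-true (⟦ A ⟧ v) a
  where
  ∨-true : ∀ a {b} → a ≡ true → a ∨ b ≡ true
  ∨-true true _ = refl

∨⊥-⊨ : A ∨f ⊥f ⊨′ A
∨⊥-⊨ {A} = ⊨⇒⊨′ λ v a → ∨-false (⟦ A ⟧ v) a
  where
  ∨-false : ∀ a → a ∨ false ≡ true → a ≡ true
  ∨-false true _ = refl

disjunctive-syllogism : (Y ∨f ¬f X) ∧f X ⊨′ Y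
disjunctive-syllogism {Y} {X} = ⊨⇒⊨′ λ v → resolve (⟦ Y ⟧ v) (⟦ X ⟧ v)
  where
  resolve : ∀ y x → (y ∨ not x) ∧ x ≡ true → y ≡ true
  resolve true  _    _ = refl
  resolve false true ()

deduction : X ∧f Z ⊨′ Y → Z ⊨′ Y ∨f ¬f X
deduction {X} {Z} {Y} (⊨⇒⊨′ X∧Z⊨Y) =
  ⊨⇒⊨′ λ v z → cases (⟦ Y ⟧ v) (⟦ X ⟧ v) (λ x → X∧Z⊨Y v (∧-true⁺ x z))
  where
  cases : ∀ y x → (x ≡ true → y ≡ true) → y ∨ not x ≡ true
  cases true  _     _   = refl
  cases false false _   = refl
  cases false true  x⇒y = x⇒y refl

⋀-++ : ∀ Γ Δ → ⋀ (Γ ++ Δ) ⊨′ ⋀ Γ ∧f ⋀ Δ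
⋀-++ []      Δ = ⊨-∧ ⊨-⊤ ⊨-refl
⋀-++ (A ∷ Γ) Δ = ⊨-∧ (⊨-∧ ∧-⊨ˡ (⊨-trans ∧-⊨ʳ (⊨-trans (⋀-++ Γ Δ) ∧-⊨ˡ)))
                     (⊨-trans ∧-⊨ʳ (⊨-trans (⋀-++ Γ Δ) ∧-⊨ʳ))

LK⁺ : ∀ Γ Δ → ⋀ Γ ⊨′ ⋁ Δ → LK Γ Δ
LK⁺ Γ Δ = ⊨′⇒⊨

LK⁻ : ∀ Γ Δ → LK Γ Δ → ⋀ Γ ⊨′ ⋁ Δ
LK⁻ Γ Δ = ⊨⇒⊨′

⊨-⋀-singleton : A ⊨′ ⋀ (A ∷ [])
⊨-⋀-singleton = ⊨-∧ ⊨-refl ⊨-⊤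

LK-singleton⁺ : B ⊨′ A → LK (B ∷ []) (A ∷ [])
LK-singleton⁺ {B} {A} B⊨A = LK⁺ (B ∷ []) (A ∷ []) (⊨-trans ∧-⊨ˡ (⊨-trans B⊨A ⊨-∨ˡ))

LK-singleton⁻ : LK (B ∷ []) (A ∷ []) → B ⊨′ A
LK-singleton⁻ {B} {A} ⊢ =
  ⊨-trans ⊨-⋀-singleton (⊨-trans (LK⁻ (B ∷ []) (A ∷ []) ⊢) ∨⊥-⊨)

WO′ : OutDer k G (A , X) → X ⊨′ Y → OutDer k G (A , Y)
WO′ d (⊨⇒⊨′ X⊨Y) = WO d X⊨Y

SI′ : OutDer k G (A , X) → B ⊨′ A → OutDer k G (B , X)
SI′ d (⊨⇒⊨′ B⊨A) = SI d B⊨A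

OutDer-mono : ∀ {p} → G ⊆ G' → OutDer k G p → OutDer k G' p
OutDer-mono G⊆G' (leaf p∈G)   = leaf (G⊆G' p∈G)
OutDer-mono G⊆G' TOP          = TOP
OutDer-mono G⊆G' BOT          = BOT
OutDer-mono G⊆G' (WO d X⊨Y)   = WO (OutDer-mono G⊆G' d) X⊨Y
OutDer-mono G⊆G' (SI d B⊨A)   = SI (OutDer-mono G⊆G' d) B⊨A
OutDer-mono G⊆G' (AND d e)    = AND (OutDer-mono G⊆G' d) (OutDer-mono G⊆G' e)
OutDer-mono G⊆G' (CT k≡3 d e) = CT k≡3 (OutDer-mono G⊆G' d) (OutDer-mono G⊆G' e)

module _ {p : Pair} (G↭p∷G' : G ↭ p ∷ G') where

  principal-∈ : p ∈ G
  principal-∈ = ∈-resp-↭ (↭-sym G↭p∷G') (here refl)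

  context-⊆ : G' ⊆ G
  context-⊆ q∈G' = ∈-resp-↭ (↭-sym G↭p∷G') (there q∈G')

triggered : G ↭ (A , X) ∷ G' → LK (B ∷ []) (A ∷ []) → OutDer k G (B , X)
triggered G↭ ⊢ = SI′ (leaf (principal-∈ G↭)) (LK-singleton⁻ ⊢)

sound : Calc k G (B , Y) → OutDer k G (B , Y)
sound {B = B} (IN ⊢) =
  WO′ (SI′ BOT (⊨-trans ⊨-⋀-singleton (LK⁻ (B ∷ []) [] ⊢))) ⊥-⊨
sound {Y = Y} (OUT ⊢) = WO′ (SI′ TOP ⊨-⊤) (⊨-trans (LK⁻ [] (Y ∷ []) ⊢) ∨⊥-⊨)
sound (E1 G↭ ⊢ c) =
  WO′ (AND (OutDer-mono (context-⊆ G↭) (sound c)) (triggered G↭ ⊢))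
      disjunctive-syllogism
sound (E3 G↭ ⊢ c) =
  WO′ (AND (CT refl (triggered G↭ ⊢) (OutDer-mono (context-⊆ G↭) (sound c)))
           (triggered G↭ ⊢))
      disjunctive-syllogism

-- OUT_3^+ feeds a fired output back into the input (this is CT); OUT_1^+ does not.
fire : Level → Fm → Fm → Fm
fire one   B X = B
fire three B X = B ∧f X

fireAll : Level → Fm → List Pair → Fm
fireAll k = foldl (λ C p → fire k C (proj₂ p))

outputs : List Pair → Fm
outputs S = ⋀ (map proj₂ S)

Fires : Level → Fm → List Pair → Set
Fires k B []            = ⊤
Fires k B ((A , X) ∷ S) = (B ⊨′ A) × Fires k (fire k B X) S

Settles : Level → Fm → List Pair → Fm → Set
Settles k B S Y = (fireAll k B S ⊨′ ⊥f) ⊎ (outputs S ⊨′ Y)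

record Witness (k : Level) (G : List Pair) (B Y : Fm) : Set where
  constructor witness
  field
    pairs   : List Pair
    from-G  : All (_∈ G) pairs
    fires   : Fires k B pairs
    settles : Settles k B pairs Y

fire-⊨ : ∀ k → fire k B X ⊨′ B
fire-⊨ one   = ⊨-refl
fire-⊨ three = ∧-⊨ˡ

fire-mono : ∀ k → B ⊨′ C → fire k B X ⊨′ fire k C X
fire-mono one   B⊨C = B⊨C
fire-mono three B⊨C = ⊨-∧ (⊨-trans ∧-⊨ˡ B⊨C) ∧-⊨ʳ

fireAll-mono : ∀ k S → B ⊨′ C → fireAll k B S ⊨′ fireAll k C S
fireAll-mono k []      B⊨C = B⊨C
fireAll-mono k (_ ∷ S) B⊨C = fireAll-mono k S (fire-mono k B⊨C)

fireAll-⊨ : ∀ k S → fireAll k B S ⊨′ B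
fireAll-⊨ k []      = ⊨-refl
fireAll-⊨ k (_ ∷ S) = ⊨-trans (fireAll-⊨ k S) (fire-⊨ k)

fireAll-++ : ∀ k S₁ S₂ → fireAll k B (S₁ ++ S₂) ≡ fireAll k (fireAll k B S₁) S₂
fireAll-++ k = foldl-++ _ _

fireAll-outputs : ∀ S → fireAll three B S ⊨′ outputs S
fireAll-outputs []      = ⊨-⊤
fireAll-outputs (_ ∷ S) =
  ⊨-∧ (⊨-trans (fireAll-⊨ three S) ∧-⊨ʳ) (fireAll-outputs S)

outputs-++ : ∀ S₁ S₂ → outputs (S₁ ++ S₂) ⊨′ outputs S₁ ∧f outputs S₂
outputs-++ S₁ S₂ =
  ⊨-trans (⊨-reflexive (cong ⋀ (map-++ proj₂ S₁ S₂))) (⋀-++ (map proj₂ S₁) _)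

Fires-antitone : ∀ k S → B ⊨′ C → Fires k C S → Fires k B S
Fires-antitone k []            B⊨C tt           = tt
Fires-antitone k ((A , X) ∷ S) B⊨C (C⊨A , fs) =
  ⊨-trans B⊨C C⊨A , Fires-antitone k S (fire-mono k B⊨C) fs

Fires-++ : ∀ k S₁ → Fires k B S₁ → Fires k (fireAll k B S₁) S₂ → Fires k B (S₁ ++ S₂)
Fires-++ k []            tt          fs₂ = fs₂
Fires-++ k ((A , X) ∷ S₁) (B⊨A , fs₁) fs₂ = B⊨A , Fires-++ k S₁ fs₁ fs₂

settles-three : ∀ S → Settles three B S Y → fireAll three B S ⊨′ Y
settles-three S (inj₁ inconsistent) = ⊨-trans inconsistent ⊥-⊨
settles-three S (inj₂ outputs⊨Y)    = ⊨-trans (fireAll-outputs S) outputs⊨Y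

witness-leaf : (B , Y) ∈ G → Witness k G B Y
witness-leaf B,Y∈G = witness (_ ∷ []) (B,Y∈G ∷ []) (⊨-refl , tt) (inj₂ ∧-⊨ˡ)

witness-WO : Witness k G B X → X ⊨′ Y → Witness k G B Y
witness-WO (witness S ∈G fs st) X⊨Y =
  witness S ∈G fs (Sum.map₂ (λ outputs⊨X → ⊨-trans outputs⊨X X⊨Y) st)

witness-SI : Witness k G A Y → B ⊨′ A → Witness k G B Y
witness-SI {k} (witness S ∈G fs st) B⊨A =
  witness S ∈G (Fires-antitone k S B⊨A fs)
    (Sum.map₁ (⊨-trans (fireAll-mono k S B⊨A)) st)

witness-AND : Witness k G A X → Witness k G A Y → Witness k G A (X ∧f Y)
witness-AND {k} {A = A} (witness S₁ ∈G₁ fs₁ st₁) (witness S₂ ∈G₂ fs₂ st₂) =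
  witness (S₁ ++ S₂) (++⁺ ∈G₁ ∈G₂)
    (Fires-++ k S₁ fs₁ (Fires-antitone k S₂ (fireAll-⊨ k S₁) fs₂))
    (settles st₁ st₂)
  where
  split : fireAll k A (S₁ ++ S₂) ⊨′ fireAll k (fireAll k A S₁) S₂
  split = ⊨-reflexive (fireAll-++ k S₁ S₂)

  settles : Settles k A S₁ X → Settles k A S₂ Y → Settles k A (S₁ ++ S₂) (X ∧f Y)
  settles (inj₁ inconsistent₁) _ =
    inj₁ (⊨-trans split (⊨-trans (fireAll-⊨ k S₂) inconsistent₁))
  settles (inj₂ _) (inj₁ inconsistent₂) =
    inj₁ (⊨-trans split (⊨-trans (fireAll-mono k S₂ (fireAll-⊨ k S₁)) inconsistent₂))
  settles (inj₂ outputs⊨X) (inj₂ outputs⊨Y) =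
    inj₂ (⊨-trans (outputs-++ S₁ S₂)
                  (⊨-∧ (⊨-trans ∧-⊨ˡ outputs⊨X) (⊨-trans ∧-⊨ʳ outputs⊨Y)))

witness-CT : Witness three G A X → Witness three G (A ∧f X) Y → Witness three G A Y
witness-CT {A = A} {X = X} (witness S₁ ∈G₁ fs₁ st₁) (witness S₂ ∈G₂ fs₂ st₂) =
  witness (S₁ ++ S₂) (++⁺ ∈G₁ ∈G₂)
    (Fires-++ three S₁ fs₁ (Fires-antitone three S₂ fired⊨A∧X fs₂))
    (Sum.map
      (λ inconsistent → ⊨-trans (⊨-reflexive (fireAll-++ three S₁ S₂))
                          (⊨-trans (fireAll-mono three S₂ fired⊨A∧X) inconsistent))
      (λ outputs⊨Y → ⊨-trans (outputs-++ S₁ S₂) (⊨-trans ∧-⊨ʳ outputs⊨Y))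
      st₂)
  where
  fired⊨A∧X : fireAll three A S₁ ⊨′ A ∧f X
  fired⊨A∧X = ⊨-∧ (fireAll-⊨ three S₁) (settles-three S₁ st₁)

complete : OutDer k G (B , Y) → Witness k G B Y
complete (leaf B,Y∈G)   = witness-leaf B,Y∈G
complete TOP            = witness [] [] tt (inj₂ ⊨-⊤)
complete BOT            = witness [] [] tt (inj₁ ⊨-refl)
complete (WO d X⊨Y)     = witness-WO (complete d) (⊨⇒⊨′ X⊨Y)
complete (SI d B⊨A)     = witness-SI (complete d) (⊨⇒⊨′ B⊨A)
complete (AND d e)      = witness-AND (complete d) (complete e)
complete (CT refl d e)  = witness-CT (complete d) (complete e)

↭-─ : ∀ {p : Pair} G (p∈G : p ∈ G) → G ↭ p ∷ (G ─ p∈G)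
↭-─ (q ∷ G) (here refl)  = ↭-refl
↭-─ (q ∷ G) (there p∈G) = ↭-trans (prep q (↭-─ G p∈G)) (swap q _ ↭-refl)

∈-─ : ∀ {p q : Pair} G (p∈G : p ∈ G) → q ∈ G → q ≡ p ⊎ q ∈ G ─ p∈G
∈-─ (r ∷ G) (here refl) (here refl) = inj₁ refl
∈-─ (r ∷ G) (here refl) (there q∈G) = inj₂ q∈G
∈-─ (r ∷ G) (there p∈G) (here refl) = inj₂ (here refl)
∈-─ (r ∷ G) (there p∈G) (there q∈G) = Sum.map₂ there (∈-─ G p∈G q∈G)

data Deletes (p : Pair) : List Pair → List Pair → Set where
  []   : Deletes p [] []
  keep : ∀ {q S T} → Deletes p S T → Deletes p (q ∷ S) (q ∷ T)
  skip : ∀ {S T}   → Deletes p S T → Deletes p (p ∷ S) T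

delete-─ : ∀ {p : Pair} G (p∈G : p ∈ G) → All (_∈ G) S →
           Σ[ T ∈ List Pair ] All (_∈ G ─ p∈G) T × Deletes p S T
delete-─ G p∈G []           = [] , [] , []
delete-─ G p∈G (q∈G ∷ S∈G) = prepend (∈-─ G p∈G q∈G) (delete-─ G p∈G S∈G)
  where
  prepend : ∀ {p q S} → q ≡ p ⊎ q ∈ G ─ p∈G →
            Σ[ T ∈ List Pair ] All (_∈ G ─ p∈G) T × Deletes p S T →
            Σ[ T ∈ List Pair ] All (_∈ G ─ p∈G) T × Deletes p (q ∷ S) T
  prepend (inj₁ refl)    (T , T∈G─p , del) = T , T∈G─p , skip del
  prepend (inj₂ q∈G─p) (T , T∈G─p , del) = _ , q∈G─p ∷ T∈G─p , keep del

-- Once an input C contains X, firing a pair with output X changes nothing.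
Contains : Level → Fm → Fm → Set
Contains k C X = C ⊨′ fire k C X

contains-fire : ∀ k → Contains k (fire k C X) X
contains-fire one   = ⊨-refl
contains-fire three = ⊨-∧ ⊨-refl ∧-⊨ʳ

contains-preserved : ∀ k → Contains k C X → Contains k (fire k C Y) X
contains-preserved one   C⊇X = C⊇X
contains-preserved three C⊇X = ⊨-∧ ⊨-refl (⊨-trans ∧-⊨ˡ (⊨-trans C⊇X ∧-⊨ʳ))

module _ {k : Level} {A X : Fm} where

  Fires-delete : Deletes (A , X) S T → Contains k C X → Fires k C S → Fires k C T
  Fires-delete []                 C⊇X tt           = tt
  Fires-delete (keep del)         C⊇X (C⊨A' , fs) =
    C⊨A' , Fires-delete del (contains-preserved k C⊇X) fs
  Fires-delete (skip {T = T} del) C⊇X (_ , fs)     =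
    Fires-antitone k T C⊇X (Fires-delete del (contains-fire k) fs)

  fireAll-delete : Deletes (A , X) S T → Contains k C X → fireAll k C T ⊨′ fireAll k C S
  fireAll-delete []                 C⊇X = ⊨-refl
  fireAll-delete (keep del)         C⊇X = fireAll-delete del (contains-preserved k C⊇X)
  fireAll-delete (skip {T = T} del) C⊇X =
    ⊨-trans (fireAll-mono k T C⊇X) (fireAll-delete del (contains-fire k))

outputs-delete : Deletes (A , X) S T → X ∧f outputs T ⊨′ outputs S
outputs-delete []         = ∧-⊨ʳ
outputs-delete (keep del) =
  ⊨-∧ (⊨-trans ∧-⊨ʳ ∧-⊨ˡ) (⊨-trans (⊨-∧ ∧-⊨ˡ (⊨-trans ∧-⊨ʳ ∧-⊨ʳ)) (outputs-delete del))
outputs-delete (skip del) = ⊨-∧ ∧-⊨ˡ (outputs-delete del)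

witness-fire : (A,X∈G : (A , X) ∈ G) → All (_∈ G) S → Fires k (fire k B X) S →
               Settles k B ((A , X) ∷ S) Y → Witness k (G ─ A,X∈G) (fire k B X) (Y ∨f ¬f X)
witness-fire {G = G} {k = k} A,X∈G S∈G fs st with delete-─ G A,X∈G S∈G
... | T , T∈G─p , del =
  witness T T∈G─p (Fires-delete del (contains-fire k) fs)
    (Sum.map
      (⊨-trans (fireAll-delete del (contains-fire k)))
      (λ outputs⊨Y → deduction (⊨-trans (⊨-∧ ∧-⊨ˡ (outputs-delete del)) outputs⊨Y))
      st)

E : ∀ k → G ↭ (A , X) ∷ G' → LK (B ∷ []) (A ∷ []) →
    Calc k G' (fire k B X , Y ∨f ¬f X) → Calc k G (B , Y)
E one   = E1
E three = E3

witness⇒Calc : ∀ n → length G ≡ n → Witness k G B Y → Calc k G (B , Y)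
witness⇒Calc {B = B} _ _ (witness [] _ _ (inj₁ inconsistent)) =
  IN (LK⁺ (B ∷ []) [] (⊨-trans ∧-⊨ˡ inconsistent))
witness⇒Calc {Y = Y} _ _ (witness [] _ _ (inj₂ ⊤⊨Y)) =
  OUT (LK⁺ [] (Y ∷ []) (⊨-trans ⊤⊨Y ⊨-∨ˡ))
witness⇒Calc {G = G} {k = k} (suc n) |G|≡1+n
  (witness ((A , X) ∷ S) (A,X∈G ∷ S∈G) (B⊨A , fs) st) =
  E k (↭-─ G A,X∈G) (LK-singleton⁺ B⊨A)
    (witness⇒Calc n |G─p|≡n (witness-fire A,X∈G S∈G fs st))
  where
  |G─p|≡n : length (G ─ A,X∈G) ≡ n
  |G─p|≡n = suc-injective (trans (sym (length-removeAt′ G (index A,X∈G))) |G|≡1+n)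
witness⇒Calc {G = []} zero _ (witness (_ ∷ _) (() ∷ _) _ _)

theorem3 : (k : Level) (G : List Pair) (p : Pair) → Calc k G p ⇔ OutDer k G p
theorem3 k G (B , Y) = mk⇔ sound (λ d → witness⇒Calc (length G) refl (complete d))
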